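{- Let $k\ge 2$ and let $\mathcal{H}$ be a $k$-uniform threshold hypergraph on $n$ vertices given by a binary sequence, with short sequence $C(a_1,\dots,a_r)_k$ and adjacency matrix $A(\mathcal{H})=(a_{i,j})$. For each $j\in\{1,\dots,r\}$ let $s_j=a_1+\dots+a_{j-1}+1$. Then, counted with multiplicity, the eigenvalues $-a_{s_j,s_j+1}$ taken with multiplicity $a_j-1$ for each $j$ with $a_j\ge 2$ provide $n-r$ eigenvalues of $A(\mathcal{H})$; that is, for every real $\lambda$, the multiplicity of $\lambda$ as an eigenvalue of $A(\mathcal{H})$ is at least $\sum_{j:\,a_j\ge 2,\ -a_{s_j,s_j+1}=\lambda}(a_j-1)$, and $\sum_{j=1}^r(a_j-1)=n-r$.
   Context: Let $k\ge 2$ and $n$ be positive integers and let $(b_1,\dots,b_n)_k$ be a binary sequence ($b_i\in\{0,1\}$) with $b_1=\dots=b_{k-1}=0$. The $k$-uniform threshold hypergraph $\mathcal{H}=(V,E)$ given by this sequence has vertex set $V=\{v_1,\dots,v_n\}$, and a set $e$ is an edge if and only if $e$ is a $k$-element subset of $V$ and $b_j=1$, where $j=\max\{i: v_i\in e\}$. The adjacency matrix $A(\mathcal{H})=(a_{i,j})$ is the $n\times n$ symmetric matrix with $a_{i,j}=|\{e\in E: v_i,v_j\in e\}|$ for $i\ne j$ and $a_{i,i}=0$. Short sequence: if $b_k=0$, $(a_1,\dots,a_r)$ are the lengths of the successive maximal runs of equal consecutive entries of $(b_1,\dots,b_n)$; if $b_k=1$, $a_1$ is the total length of the first two runs (the initial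 $k-1$ zeros together with the following run of ones) and $a_2,\dots,a_r$ are the lengths of the subsequent maximal runs. In particular $a_1+\dots+a_r=n$. -}

module Defs where

open import Data.Bool using (Bool; true; false; if_then_else_; _∧_)
open import Data.Nat using (ℕ; zero; suc; _+_; _∸_; _≡ᵇ_; _≤ᵇ_)
open import Data.Fin using (Fin; toℕ)
open import Data.Vec using (Vec; []; _∷_; lookup; toList)
open import Data.List using (List; []; _∷_; map; _++_; filterᵇ; length)
open import Data.Maybe using (Maybe; just; nothing)
open import Data.Integer as ℤ using (ℤ; +_; -_)
open import Data.Product using (Σ; _×_)
open import Relation.Nullary using (does)
open import Relation.Binary.PropositionalEquality using (_≡_)

-- Vertices v_1,…,v_n are represented by Fin n (v_{i+1} ↦ index i).
-- A binary sequence (b_1,…,b_n) is a Vec Bool n (true = 1).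
-- A subset of the vertex set is its characteristic vector Vec Bool n.

subsets : (n : ℕ) → List (Vec Bool n)
subsets zero = [] ∷ []
subsets (suc n) = map (false ∷_) (subsets n) ++ map (true ∷_) (subsets n)

card : ∀ {n} → Vec Bool n → ℕ
card [] = 0
card (x ∷ xs) = (if x then 1 else 0) + card xs

maxElem : ∀ {n} → Vec Bool n → Maybe (Fin n)
maxElem [] = nothing
maxElem (x ∷ xs) with maxElem xs
... | just i = just (Data.Fin.suc i)
... | nothing = if x then just Data.Fin.zero else nothing

-- entry at a ℕ index (false when out of range)
at : ∀ {n} → Vec Bool n → ℕ → Bool
at [] _ = false
at (x ∷ xs) zero = x
at (x ∷ xs) (suc i) = at xs i

isEdge : ∀ {n} → ℕ → Vec Bool n → Vec Bool n → Bool
isEdge k b e with maxElem e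
... | just m = (card e ≡ᵇ k) ∧ lookup b m
... | nothing = false

edges : ∀ {n} → ℕ → Vec Bool n → List (Vec Bool n)
edges {n} k b = filterᵇ (isEdge k b) (subsets n)

adjEntry : ∀ {n} → ℕ → Vec Bool n → ℕ → ℕ → ℕ
adjEntry k b i j =
  if i ≡ᵇ j then 0 else length (filterᵇ (λ e → at e i ∧ at e j) (edges k b))

adjMatrix : ∀ {n} → ℕ → Vec Bool n → Fin n → Fin n → ℤ
adjMatrix k b i j = + adjEntry k b (toℕ i) (toℕ j)

sameBool : Bool → Bool → Bool
sameBool true true = true
sameBool false false = true
sameBool _ _ = false

runsFrom : Bool → ℕ → List Bool → List ℕ
runsFrom c len [] = len ∷ []
runsFrom c len (y ∷ ys) =
  if sameBool y c then runsFrom c (suc len) ys else len ∷ runsFrom y 1 ys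

runs : List Bool → List ℕ
runs [] = []
runs (x ∷ xs) = runsFrom x 1 xs

mergeFirstTwo : List ℕ → List ℕ
mergeFirstTwo (x ∷ y ∷ rest) = (x + y) ∷ rest
mergeFirstTwo l = l

-- the short sequence (a_1,…,a_r): runs of b, with the first two runs merged
-- when b_k = 1 (b_k is the entry at 0-based index k ∸ 1)
shortSeq : ∀ {n} → ℕ → Vec Bool n → List ℕ
shortSeq k b = if at b (k ∸ 1) then mergeFirstTwo (runs (toList b)) else runs (toList b)

-- Σ over j with a_j ≥ 2 and -a_{s_j,s_j+1} = μ of (a_j - 1).
-- The accumulator is s_j - 1 = a_1 + … + a_{j-1}, i.e. the 0-based index of v_{s_j}.
targetFrom : ∀ {n} → ℕ → Vec Bool n → ℤ → ℕ → List ℕ → ℕ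
targetFrom k b μ acc [] = 0
targetFrom k b μ acc (a ∷ as) =
  (if (2 ≤ᵇ a) ∧ does ((ℤ.- (+ adjEntry k b acc (suc acc))) ℤ.≟ μ) then a ∸ 1 else 0)
  + targetFrom k b μ (acc + a) as

target : ∀ {n} → ℕ → Vec Bool n → ℤ → ℕ
target k b μ = targetFrom k b μ 0 (shortSeq k b)

sumFin : ∀ {n} → (Fin n → ℤ) → ℤ
sumFin {zero} f = + 0
sumFin {suc n} f = f Data.Fin.zero ℤ.+ sumFin (λ i → f (Data.Fin.suc i))

IsEigenSolution : ∀ {n} → (Fin n → Fin n → ℤ) → ℤ → (Fin n → ℤ) → Set
IsEigenSolution A μ v = ∀ i → sumFin (λ j → A i j ℤ.* v j) ≡ μ ℤ.* v i

-- linear independence of a family of m integer vectors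
-- (over ℤ; equivalent to over ℚ and over ℝ by clearing denominators)
LinIndep : ∀ {m n} → (Fin m → Fin n → ℤ) → Set
LinIndep {m} vs = (c : Fin m → ℤ) →
  (∀ i → sumFin (λ t → c t ℤ.* vs t i) ≡ + 0) → ∀ t → c t ≡ + 0

-- μ is an eigenvalue of A of (geometric = algebraic, A symmetric) multiplicity ≥ m:
-- the μ-eigenspace contains m linearly independent vectors
EigenMultAtLeast : ∀ {n} → (Fin n → Fin n → ℤ) → ℤ → ℕ → Set
EigenMultAtLeast {n} A μ m =
  Σ (Fin m → Fin n → ℤ) λ vs → LinIndep vs × (∀ t → IsEigenSolution A μ (vs t))

module Submission where

-- Call the positions p, p+1 of b twins when b_p = b_{p+1} or both are among the first k.  Exchanging two
-- twin vertices maps edges to edges (in the second case a k-set whose maximum is one of them must be the set of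
-- the first k vertices), so it fixes A.  Hence columns p and p+1 of A agree off rows p, p+1, e_p − e_{p+1} is an
-- eigenvector for −a_{p,p+1}, and along a block of consecutive twins these eigenvalues all coincide.  Every block
-- of the short sequence is such a block: runs are constant, and when b_k = 1 the first run lies inside the first
-- k − 1 positions.  A block of length a_j thus yields a_j − 1 vectors e_p − e_{p+1}; all of them together are
-- independent because their leading coordinates p are distinct.

open import Algebra.Bundles using (CommutativeMonoid)
open import Data.Bool using (Bool; true; false; if_then_else_; _∧_; _∨_; T)
open import Data.Bool.Properties using (∧-zeroʳ; ∨-zeroʳ; ∨-commutativeMonoid; T-≡)
open import Data.Fin as Fin using (Fin; toℕ; fromℕ<)
open import Data.Fin.Properties using (toℕ-fromℕ<)
open import Data.Integer as ℤ using (ℤ; 0ℤ; 1ℤ; -1ℤ)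
import Data.Integer.Properties as ℤ
open import Data.Integer.Tactic.RingSolver using (solve-∀)
open import Data.List as List using (List; []; _∷_; map; _++_; filterᵇ; length; applyUpTo)
open import Data.List.Membership.Propositional.Properties using (∈-lookup)
open import Data.List.Properties using (length-++; length-applyUpTo)
open import Data.List.Relation.Unary.All as All using (All; []; _∷_)
import Data.List.Relation.Unary.All.Properties as All
open import Data.List.Relation.Unary.AllPairs using (AllPairs; []; _∷_)
import Data.List.Relation.Unary.AllPairs.Properties as AllPairs
open import Data.Maybe using (just; nothing; is-just; maybe′)
open import Data.Nat using (ℕ; zero; suc; _+_; _∸_; _≡ᵇ_; _≤ᵇ_; _≤_; _<_; z≤n; s≤s; z<s)
open import Data.Nat.ListAction using (sum)
open import Data.Nat.Properties
open import Data.Product as Product using (Σ; _×_; _,_; proj₁; proj₂)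
open import Data.Sum using (_⊎_; inj₁; inj₂)
open import Data.Unit using (⊤; tt)
open import Data.Vec using (Vec; []; _∷_; lookup; toList)
open import Data.Vec.Properties using (length-toList)
open import Defs
open import Function using (_∘_)
open import Function.Bundles using (Equivalence)
open import Relation.Binary.PropositionalEquality
open import Relation.Nullary using (contradiction; yes; no)
open import Algebra.Properties.CommutativeSemigroup +-commutativeSemigroup
  using () renaming (interchange to +-interchange; x∙yz≈y∙xz to +-leftComm)
open import Algebra.Properties.CommutativeSemigroup (CommutativeMonoid.commutativeSemigroup ∨-commutativeMonoid)
  using () renaming (x∙yz≈y∙xz to ∨-leftComm)

countᵇ : ∀ {A : Set} → (A → Bool) → List A → ℕ
countᵇ P xs = length (filterᵇ P xs)

countᵇ-++ : ∀ {A : Set} (P : A → Bool) xs ys → countᵇ P (xs ++ ys) ≡ countᵇ P xs + countᵇ P ys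
countᵇ-++ P [] ys = refl
countᵇ-++ P (x ∷ xs) ys with P x
... | true = cong suc (countᵇ-++ P xs ys)
... | false = countᵇ-++ P xs ys

countᵇ-map : ∀ {A B : Set} (P : B → Bool) (f : A → B) xs → countᵇ P (map f xs) ≡ countᵇ (λ x → P (f x)) xs
countᵇ-map P f [] = refl
countᵇ-map P f (x ∷ xs) with P (f x)
... | true = cong suc (countᵇ-map P f xs)
... | false = countᵇ-map P f xs

countᵇ-cong : ∀ {A : Set} {P Q : A → Bool} → (∀ x → P x ≡ Q x) → ∀ xs → countᵇ P xs ≡ countᵇ Q xs
countᵇ-cong P≗Q [] = refl
countᵇ-cong {P = P} {Q} P≗Q (x ∷ xs) with P x | Q x | P≗Q x
... | true  | .true  | refl = cong suc (countᵇ-cong P≗Q xs)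
... | false | .false | refl = countᵇ-cong P≗Q xs

countᵇ-filterᵇ : ∀ {A : Set} (P Q : A → Bool) xs → countᵇ Q (filterᵇ P xs) ≡ countᵇ (λ x → P x ∧ Q x) xs
countᵇ-filterᵇ P Q [] = refl
countᵇ-filterᵇ P Q (x ∷ xs) with P x
... | false = countᵇ-filterᵇ P Q xs
... | true with Q x
...   | true = cong suc (countᵇ-filterᵇ P Q xs)
...   | false = countᵇ-filterᵇ P Q xs

countᵇ-subsets-suc : ∀ {n} (P : Vec Bool (suc n) → Bool) →
  countᵇ P (subsets (suc n))
    ≡ countᵇ (λ e → P (false ∷ e)) (subsets n) + countᵇ (λ e → P (true ∷ e)) (subsets n)
countᵇ-subsets-suc {n} P = begin
  countᵇ P (map (false ∷_) (subsets n) ++ map (true ∷_) (subsets n))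
    ≡⟨ countᵇ-++ P (map (false ∷_) (subsets n)) (map (true ∷_) (subsets n)) ⟩
  countᵇ P (map (false ∷_) (subsets n)) + countᵇ P (map (true ∷_) (subsets n))
    ≡⟨ cong₂ _+_ (countᵇ-map P (false ∷_) (subsets n)) (countᵇ-map P (true ∷_) (subsets n)) ⟩
  countᵇ (λ e → P (false ∷ e)) (subsets n) + countᵇ (λ e → P (true ∷ e)) (subsets n) ∎
  where open ≡-Reasoning

swapAt : ∀ {A : Set} {n} → ℕ → Vec A n → Vec A n
swapAt _ [] = []
swapAt zero (x ∷ []) = x ∷ []
swapAt zero (x ∷ y ∷ xs) = y ∷ x ∷ xs
swapAt (suc p) (x ∷ xs) = x ∷ swapAt p xs

countᵇ-subsets-swapAt : ∀ n p (P : Vec Bool n → Bool) →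
  countᵇ P (subsets n) ≡ countᵇ (λ e → P (swapAt p e)) (subsets n)
countᵇ-subsets-swapAt zero p P =
  countᵇ-cong {P = P} {λ e → P (swapAt p e)} (λ { [] → refl }) (subsets 0)
countᵇ-subsets-swapAt (suc zero) zero P =
  countᵇ-cong {P = P} {λ e → P (swapAt 0 e)} (λ { (x ∷ []) → refl }) (subsets 1)
-- Split along the first two coordinates: swapAt 0 just exchanges the counts c₀₁ and c₁₀.
countᵇ-subsets-swapAt (suc (suc n)) zero P = begin
  countᵇ P (subsets (2 + n))
    ≡⟨ countᵇ-subsets-suc P ⟩
  countᵇ (λ e → P (false ∷ e)) (subsets (suc n)) + countᵇ (λ e → P (true ∷ e)) (subsets (suc n))
    ≡⟨ cong₂ _+_ (countᵇ-subsets-suc (λ e → P (false ∷ e))) (countᵇ-subsets-suc (λ e → P (true ∷ e))) ⟩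
  (c₀₀ + c₀₁) + (c₁₀ + c₁₁)
    ≡⟨ +-interchange c₀₀ c₀₁ c₁₀ c₁₁ ⟩
  (c₀₀ + c₁₀) + (c₀₁ + c₁₁)
    ≡⟨ cong₂ _+_ (countᵇ-subsets-suc (λ e → P (swapAt 0 (false ∷ e))))
                 (countᵇ-subsets-suc (λ e → P (swapAt 0 (true ∷ e)))) ⟨
  countᵇ (λ e → P (swapAt 0 (false ∷ e))) (subsets (suc n))
    + countᵇ (λ e → P (swapAt 0 (true ∷ e))) (subsets (suc n))
    ≡⟨ countᵇ-subsets-suc (λ e → P (swapAt 0 e)) ⟨
  countᵇ (λ e → P (swapAt 0 e)) (subsets (2 + n)) ∎
  where
  open ≡-Reasoning
  count₂ : Bool → Bool → ℕ
  count₂ x y = countᵇ (λ e → P (x ∷ y ∷ e)) (subsets n)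
  c₀₀ c₀₁ c₁₀ c₁₁ : ℕ
  c₀₀ = count₂ false false
  c₀₁ = count₂ false true
  c₁₀ = count₂ true false
  c₁₁ = count₂ true true
countᵇ-subsets-swapAt (suc n) (suc p) P = begin
  countᵇ P (subsets (suc n))
    ≡⟨ countᵇ-subsets-suc P ⟩
  countᵇ (λ e → P (false ∷ e)) (subsets n) + countᵇ (λ e → P (true ∷ e)) (subsets n)
    ≡⟨ cong₂ _+_ (countᵇ-subsets-swapAt n p (λ e → P (false ∷ e)))
                 (countᵇ-subsets-swapAt n p (λ e → P (true ∷ e))) ⟩
  countᵇ (λ e → P (false ∷ swapAt p e)) (subsets n) + countᵇ (λ e → P (true ∷ swapAt p e)) (subsets n)
    ≡⟨ countᵇ-subsets-suc (λ e → P (swapAt (suc p) e)) ⟨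
  countᵇ (λ e → P (swapAt (suc p) e)) (subsets (suc n)) ∎
  where open ≡-Reasoning

nonempty : ∀ {n} → Vec Bool n → Bool
nonempty [] = false
nonempty (x ∷ xs) = x ∨ nonempty xs

topBit : ∀ {n} → Vec Bool n → Vec Bool n → Bool
topBit [] [] = false
topBit (c ∷ b) (x ∷ e) = if nonempty e then topBit b e else x ∧ c

nonempty-maxElem : ∀ {n} (e : Vec Bool n) → nonempty e ≡ is-just (maxElem e)
nonempty-maxElem [] = refl
nonempty-maxElem (x ∷ e) with maxElem e | nonempty-maxElem e
... | just _  | eq rewrite eq = ∨-zeroʳ x
... | nothing | eq rewrite eq with x
...   | true = refl
...   | false = refl

topBit-maxElem : ∀ {n} (b e : Vec Bool n) → maybe′ (lookup b) false (maxElem e) ≡ topBit b e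
topBit-maxElem [] [] = refl
topBit-maxElem (c ∷ b) (x ∷ e) with maxElem e | nonempty-maxElem e | topBit-maxElem b e
... | just _  | eq | ih rewrite eq = ih
... | nothing | eq | ih rewrite eq with x
...   | true = refl
...   | false = refl

isEdge-topBit : ∀ {n} k (b e : Vec Bool n) → isEdge k b e ≡ (card e ≡ᵇ k) ∧ topBit b e
isEdge-topBit k b e with maxElem e | topBit-maxElem b e
... | just _  | eq = cong ((card e ≡ᵇ k) ∧_) eq
... | nothing | eq = trans (sym (∧-zeroʳ _)) (cong ((card e ≡ᵇ k) ∧_) eq)

bit : Bool → ℕ
bit x = if x then 1 else 0

bit≤1 : ∀ x → bit x ≤ 1
bit≤1 true = s≤s z≤n
bit≤1 false = z≤n

card-swapAt : ∀ {n} p (e : Vec Bool n) → card (swapAt p e) ≡ card e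
card-swapAt _ [] = refl
card-swapAt zero (x ∷ []) = refl
card-swapAt zero (x ∷ y ∷ e) = +-leftComm (bit y) (bit x) (card e)
card-swapAt (suc p) (x ∷ e) = cong (bit x +_) (card-swapAt p e)

nonempty-swapAt : ∀ {n} p (e : Vec Bool n) → nonempty (swapAt p e) ≡ nonempty e
nonempty-swapAt _ [] = refl
nonempty-swapAt zero (x ∷ []) = refl
nonempty-swapAt zero (x ∷ y ∷ e) = ∨-leftComm y x (nonempty e)
nonempty-swapAt (suc p) (x ∷ e) = cong (x ∨_) (nonempty-swapAt p e)

card-empty : ∀ {n} (e : Vec Bool n) → nonempty e ≡ false → card e ≡ 0
card-empty [] _ = refl
card-empty (false ∷ e) h = card-empty e h

topBit-swapAt-equal : ∀ {n} p (b e : Vec Bool n) → at b p ≡ at b (suc p) → topBit b (swapAt p e) ≡ topBit b e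
topBit-swapAt-equal _ [] [] _ = refl
topBit-swapAt-equal zero (c ∷ []) (x ∷ []) _ = refl
topBit-swapAt-equal zero (c ∷ d ∷ b) (x ∷ y ∷ e) refl with nonempty e | x | y
... | true  | true  | true  = refl
... | true  | true  | false = refl
... | true  | false | true  = refl
... | true  | false | false = refl
... | false | true  | true  = refl
... | false | true  | false = refl
... | false | false | true  = refl
... | false | false | false = refl
topBit-swapAt-equal (suc p) (c ∷ b) (x ∷ e) h rewrite nonempty-swapAt p e with nonempty e
... | true = topBit-swapAt-equal p b e h
... | false = refl

-- A set with more than p + 1 elements has its maximum at p + 1 only if it contains 0, …, p + 1.
topBit-swapAt-large : ∀ {n} p (b e : Vec Bool n) → suc p < card e → topBit b (swapAt p e) ≡ topBit b e
topBit-swapAt-large zero [] [] ()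
topBit-swapAt-large zero (c ∷ []) (x ∷ []) _ = refl
topBit-swapAt-large zero (c ∷ d ∷ b) (x ∷ y ∷ e) h with nonempty e in eq
... | true with x | y
...   | true  | true  = refl
...   | true  | false = refl
...   | false | true  = refl
...   | false | false = refl
topBit-swapAt-large zero (c ∷ d ∷ b) (x ∷ y ∷ e) h | false
  with x | y | subst (λ m → 2 ≤ bit x + (bit y + m)) (card-empty e eq) h
...   | true  | true  | _ = refl
...   | true  | false | s≤s ()
...   | false | true  | s≤s ()
...   | false | false | ()
topBit-swapAt-large (suc p) (c ∷ b) (x ∷ e) h rewrite nonempty-swapAt p e with nonempty e in eq
... | true = topBit-swapAt-large p b e (≤-pred (≤-trans h (+-monoˡ-≤ (card e) (bit≤1 x))))
... | false = contradiction (≤-trans h bit+card≤1) λ { (s≤s ()) }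
  where
  bit+card≤1 : bit x + card e ≤ 1
  bit+card≤1 = subst (_≤ 1) (sym (trans (cong (bit x +_) (card-empty e eq)) (+-identityʳ (bit x)))) (bit≤1 x)

transpose : ℕ → ℕ → ℕ
transpose zero zero = 1
transpose zero (suc zero) = 0
transpose zero (suc (suc i)) = suc (suc i)
transpose (suc p) zero = zero
transpose (suc p) (suc i) = suc (transpose p i)

transpose-≡ᵇ : ∀ p i j → (transpose p i ≡ᵇ transpose p j) ≡ (i ≡ᵇ j)
transpose-≡ᵇ zero zero zero = refl
transpose-≡ᵇ zero zero (suc zero) = refl
transpose-≡ᵇ zero zero (suc (suc j)) = refl
transpose-≡ᵇ zero (suc zero) zero = refl
transpose-≡ᵇ zero (suc zero) (suc zero) = refl
transpose-≡ᵇ zero (suc zero) (suc (suc j)) = refl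
transpose-≡ᵇ zero (suc (suc i)) zero = refl
transpose-≡ᵇ zero (suc (suc i)) (suc zero) = refl
transpose-≡ᵇ zero (suc (suc i)) (suc (suc j)) = refl
transpose-≡ᵇ (suc p) zero zero = refl
transpose-≡ᵇ (suc p) zero (suc j) = refl
transpose-≡ᵇ (suc p) (suc i) zero = refl
transpose-≡ᵇ (suc p) (suc i) (suc j) = transpose-≡ᵇ p i j

transpose-left : ∀ p → transpose p p ≡ suc p
transpose-left zero = refl
transpose-left (suc p) = cong suc (transpose-left p)

transpose-right : ∀ p → transpose p (suc p) ≡ p
transpose-right zero = refl
transpose-right (suc p) = cong suc (transpose-right p)

transpose-other : ∀ p i → i ≢ p → i ≢ suc p → transpose p i ≡ i
transpose-other zero zero i≢p _ = contradiction refl i≢p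
transpose-other zero (suc zero) _ i≢1+p = contradiction refl i≢1+p
transpose-other zero (suc (suc i)) _ _ = refl
transpose-other (suc p) zero _ _ = refl
transpose-other (suc p) (suc i) i≢p i≢1+p =
  cong suc (transpose-other p i (i≢p ∘ cong suc) (i≢1+p ∘ cong suc))

at-swapAt : ∀ {n} p (e : Vec Bool n) → suc p < n → ∀ i → at (swapAt p e) (transpose p i) ≡ at e i
at-swapAt zero (x ∷ y ∷ e) _ zero = refl
at-swapAt zero (x ∷ y ∷ e) _ (suc zero) = refl
at-swapAt zero (x ∷ y ∷ e) _ (suc (suc i)) = refl
at-swapAt zero (x ∷ []) (s≤s ()) _
at-swapAt (suc p) (x ∷ e) _ zero = refl
at-swapAt (suc p) (x ∷ e) (s≤s 2+p<n) (suc i) = at-swapAt p e 2+p<n i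

-- unitDiff q x is the x-th coordinate of e_q − e_{q+1}.
unitDiff : ℕ → ℕ → ℤ
unitDiff zero zero = 1ℤ
unitDiff zero (suc zero) = -1ℤ
unitDiff zero (suc (suc x)) = 0ℤ
unitDiff (suc q) zero = 0ℤ
unitDiff (suc q) (suc x) = unitDiff q x

unitDiff-self : ∀ q → unitDiff q q ≡ 1ℤ
unitDiff-self zero = refl
unitDiff-self (suc q) = unitDiff-self q

unitDiff-next : ∀ q → unitDiff q (suc q) ≡ -1ℤ
unitDiff-next zero = refl
unitDiff-next (suc q) = unitDiff-next q

unitDiff-other : ∀ q x → x ≢ q → x ≢ suc q → unitDiff q x ≡ 0ℤ
unitDiff-other zero zero x≢q _ = contradiction refl x≢q
unitDiff-other zero (suc zero) _ x≢1+q = contradiction refl x≢1+q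
unitDiff-other zero (suc (suc x)) _ _ = refl
unitDiff-other (suc q) zero _ _ = refl
unitDiff-other (suc q) (suc x) x≢q x≢1+q = unitDiff-other q x (x≢q ∘ cong suc) (x≢1+q ∘ cong suc)

sumFin-cong : ∀ {n} {f g : Fin n → ℤ} → (∀ i → f i ≡ g i) → sumFin f ≡ sumFin g
sumFin-cong {zero} _ = refl
sumFin-cong {suc n} f≗g = cong₂ ℤ._+_ (f≗g Fin.zero) (sumFin-cong (f≗g ∘ Fin.suc))

sumFin-zero : ∀ n → sumFin {n} (λ _ → 0ℤ) ≡ 0ℤ
sumFin-zero zero = refl
sumFin-zero (suc n) = trans (ℤ.+-identityˡ _) (sumFin-zero n)

sumFin-unitDiff : ∀ {n} q (g : ℕ → ℤ) → suc q < n →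
  sumFin {n} (λ j → g (toℕ j) ℤ.* unitDiff q (toℕ j)) ≡ g q ℤ.- g (suc q)
sumFin-unitDiff {suc (suc n)} zero g _ = begin
  g 0 ℤ.* 1ℤ ℤ.+ (g 1 ℤ.* -1ℤ ℤ.+ sumFin {n} (λ j → g (2 + toℕ j) ℤ.* 0ℤ))
    ≡⟨ cong (λ s → g 0 ℤ.* 1ℤ ℤ.+ (g 1 ℤ.* -1ℤ ℤ.+ s))
            (trans (sumFin-cong {n} (λ j → ℤ.*-zeroʳ (g (2 + toℕ j)))) (sumFin-zero n)) ⟩
  g 0 ℤ.* 1ℤ ℤ.+ (g 1 ℤ.* -1ℤ ℤ.+ 0ℤ)
    ≡⟨ collect (g 0) (g 1) ⟩
  g 0 ℤ.- g 1 ∎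
  where
  open ≡-Reasoning
  collect : ∀ a c → a ℤ.* 1ℤ ℤ.+ (c ℤ.* -1ℤ ℤ.+ 0ℤ) ≡ a ℤ.- c
  collect = solve-∀
sumFin-unitDiff {suc n} (suc q) g (s≤s 1+q<n) =
  trans (cong (ℤ._+ rest) (ℤ.*-zeroʳ (g 0))) (trans (ℤ.+-identityˡ rest) (sumFin-unitDiff q (g ∘ suc) 1+q<n))
  where
  rest : ℤ
  rest = sumFin {n} (λ j → g (suc (toℕ j)) ℤ.* unitDiff q (toℕ j))

diffVector : ∀ {n} → ℕ → Fin n → ℤ
diffVector q j = unitDiff q (toℕ j)

diffVectors : ∀ {n} (Q : List ℕ) → Fin (length Q) → Fin n → ℤ
diffVectors Q t = diffVector (List.lookup Q t)

diffVectors-vanish : ∀ {n} q Q → All (q <_) Q → (i : Fin n) → toℕ i ≡ q → ∀ t → diffVectors Q t i ≡ 0ℤ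
diffVectors-vanish q (q′ ∷ Q) (q<q′ ∷ _) i refl Fin.zero =
  unitDiff-other q′ q (<⇒≢ q<q′) (<⇒≢ (m<n⇒m<1+n q<q′))
diffVectors-vanish q (q′ ∷ Q) (_ ∷ q<Q) i i≡q (Fin.suc t) = diffVectors-vanish q Q q<Q i i≡q t

diffVectors-linIndep : ∀ {n} Q → AllPairs _<_ Q → All (λ q → suc q < n) Q →
  LinIndep {length Q} {n} (diffVectors Q)
diffVectors-linIndep [] _ _ _ _ ()
diffVectors-linIndep {n} (q ∷ Q) (q<Q ∷ sorted) (1+q<n ∷ bounded) c combination≡0 = coefficient≡0
  where
  open ≡-Reasoning
  headTerm tailSum : Fin n → ℤ
  headTerm i = c Fin.zero ℤ.* diffVector q i
  tailSum i = sumFin (λ t → c (Fin.suc t) ℤ.* diffVectors Q t i)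
  iq : Fin n
  iq = fromℕ< (<-trans (n<1+n q) 1+q<n)
  iq≡q : toℕ iq ≡ q
  iq≡q = toℕ-fromℕ< _
  tailSum-iq : tailSum iq ≡ 0ℤ
  tailSum-iq = trans (sumFin-cong λ t → trans (cong (c (Fin.suc t) ℤ.*_) (diffVectors-vanish q Q q<Q iq iq≡q t))
                                              (ℤ.*-zeroʳ (c (Fin.suc t))))
                     (sumFin-zero (length Q))
  head≡0 : c Fin.zero ≡ 0ℤ
  head≡0 = begin
    c Fin.zero                    ≡⟨ ℤ.*-identityʳ (c Fin.zero) ⟨
    c Fin.zero ℤ.* 1ℤ             ≡⟨ cong (c Fin.zero ℤ.*_) (trans (cong (unitDiff q) iq≡q) (unitDiff-self q)) ⟨
    headTerm iq                   ≡⟨ ℤ.+-identityʳ (headTerm iq) ⟨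
    headTerm iq ℤ.+ 0ℤ            ≡⟨ cong (λ s → headTerm iq ℤ.+ s) tailSum-iq ⟨
    headTerm iq ℤ.+ tailSum iq    ≡⟨ combination≡0 iq ⟩
    0ℤ                            ∎
  tailSum≡0 : ∀ i → tailSum i ≡ 0ℤ
  tailSum≡0 i = begin
    tailSum i                             ≡⟨ ℤ.+-identityˡ (tailSum i) ⟨
    0ℤ ℤ.+ tailSum i                      ≡⟨ cong (ℤ._+ tailSum i) (ℤ.*-zeroˡ (diffVector q i)) ⟨
    0ℤ ℤ.* diffVector q i ℤ.+ tailSum i   ≡⟨ cong (λ a → a ℤ.* diffVector q i ℤ.+ tailSum i) head≡0 ⟨
    headTerm i ℤ.+ tailSum i              ≡⟨ combination≡0 i ⟩
    0ℤ                                    ∎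
  coefficient≡0 : ∀ t → c t ≡ 0ℤ
  coefficient≡0 Fin.zero = head≡0
  coefficient≡0 (Fin.suc t) = diffVectors-linIndep Q sorted bounded (c ∘ Fin.suc) tailSum≡0 t

<∸1⇒1+< : ∀ {i a} → i < a ∸ 1 → suc i < a
<∸1⇒1+< {a = suc a} i<a∸1 = s≤s i<a∸1

atList : List Bool → ℕ → Bool
atList [] _ = false
atList (x ∷ xs) zero = x
atList (x ∷ xs) (suc i) = atList xs i

at-toList : ∀ {n} (b : Vec Bool n) i → at b i ≡ atList (toList b) i
at-toList [] i = refl
at-toList (x ∷ xs) zero = refl
at-toList (x ∷ xs) (suc i) = at-toList xs i

sameBool⇒≡ : ∀ {x y} → sameBool x y ≡ true → x ≡ y
sameBool⇒≡ {true} {true} _ = refl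
sameBool⇒≡ {false} {false} _ = refl

RunBlock : (ℕ → Bool) → ℕ → ℕ → Set
RunBlock f s a = 0 < a × (∀ i → i < a → f (s + i) ≡ f s)

RunBlocks : (ℕ → Bool) → ℕ → List ℕ → Set
RunBlocks f s [] = ⊤
RunBlocks f s (a ∷ as) = RunBlock f s a × RunBlocks f (s + a) as

runBlock : ∀ f s {a c} → 0 < a → (∀ i → i < a → f (s + i) ≡ c) → RunBlock f s a
runBlock f s 0<a const = 0<a , λ i i<a →
   trans (const i i<a) (sym (trans (cong f (sym (+-identityʳ s))) (const 0 0<a)))

runsFrom-runBlocks : ∀ f c len ys s → 0 < len →
  (∀ i → i < len → f (s + i) ≡ c) → (∀ j → f (s + len + j) ≡ atList ys j) →
  RunBlocks f s (runsFrom c len ys) × sum (runsFrom c len ys) ≡ len + length ys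
runsFrom-runBlocks f c len [] s 0<len const _ = (runBlock f s 0<len const , tt) , refl
runsFrom-runBlocks f c len (y ∷ ys) s 0<len const rest with sameBool y c in same
... | true = Product.map₂ (λ total → trans total (sym (+-suc len (length ys))))
  (runsFrom-runBlocks f c (suc len) ys s z<s const′ rest′)
  where
  const′ : ∀ i → i < suc len → f (s + i) ≡ c
  const′ i i<1+len with m≤n⇒m<n∨m≡n i<1+len
  ... | inj₁ (s≤s i<len) = const i i<len
  ... | inj₂ refl = trans (trans (cong f (sym (+-identityʳ (s + len)))) (rest 0)) (sameBool⇒≡ same)
  rest′ : ∀ j → f (s + suc len + j) ≡ atList ys j
  rest′ j = trans (cong f (trans (cong (_+ j) (+-suc s len)) (sym (+-suc (s + len) j)))) (rest (suc j))
... | false = Product.map (runBlock f s 0<len const ,_) (cong (len +_))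
  (runsFrom-runBlocks f y 1 ys (s + len) z<s (λ { zero _ → rest 0 ; (suc _) (s≤s ()) })
                                            (λ j → trans (cong f (+-assoc (s + len) 1 j)) (rest (suc j))))

runs-runBlocks : ∀ {n} (b : Vec Bool n) → RunBlocks (at b) 0 (runs (toList b)) × sum (runs (toList b)) ≡ n
runs-runBlocks [] = tt , refl
runs-runBlocks (x ∷ b) = Product.map₂ (λ total → trans total (cong suc (length-toList b)))
  (runsFrom-runBlocks (at (x ∷ b)) x 1 (toList b) 0 z<s (λ { zero _ → refl ; (suc _) (s≤s ()) }) (at-toList b))

runBlocks-positive : ∀ f s as → RunBlocks f s as → All (0 <_) as
runBlocks-positive f s [] tt = []
runBlocks-positive f s (a ∷ as) ((0<a , _) , blocks) = 0<a ∷ runBlocks-positive f (s + a) as blocks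

runs-positive : ∀ {n} (b : Vec Bool n) → All (0 <_) (runs (toList b))
runs-positive b = runBlocks-positive (at b) 0 _ (proj₁ (runs-runBlocks b))

sum-mergeFirstTwo : ∀ as → sum (mergeFirstTwo as) ≡ sum as
sum-mergeFirstTwo [] = refl
sum-mergeFirstTwo (a ∷ []) = refl
sum-mergeFirstTwo (a₁ ∷ a₂ ∷ as) = +-assoc a₁ a₂ (sum as)

mergeFirstTwo-positive : ∀ {as} → All (0 <_) as → All (0 <_) (mergeFirstTwo as)
mergeFirstTwo-positive [] = []
mergeFirstTwo-positive (0<a ∷ []) = 0<a ∷ []
mergeFirstTwo-positive (0<a₁ ∷ _ ∷ ps) = <-≤-trans 0<a₁ (m≤m+n _ _) ∷ ps

sum-map-pred : ∀ as → All (0 <_) as → sum (map (λ a → a ∸ 1) as) + length as ≡ sum as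
sum-map-pred [] [] = refl
sum-map-pred (suc a ∷ as) (_ ∷ ps) = begin
  a + sum (map (λ a → a ∸ 1) as) + suc (length as)   ≡⟨ +-suc _ (length as) ⟩
  suc (a + sum (map (λ a → a ∸ 1) as) + length as)   ≡⟨ cong suc (+-assoc a _ (length as)) ⟩
  suc (a + (sum (map (λ a → a ∸ 1) as) + length as)) ≡⟨ cong (λ m → suc (a + m)) (sum-map-pred as ps) ⟩
  suc (a + sum as)                                   ∎
  where open ≡-Reasoning

module _ (k : ℕ) {n : ℕ} (b : Vec Bool n) where

  Twins : ℕ → Set
  Twins p = (at b p ≡ at b (suc p)) ⊎ (suc p < k)

  isEdge-swapAt : ∀ p → Twins p → ∀ e → isEdge k b (swapAt p e) ≡ isEdge k b e
  isEdge-swapAt p twins e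
    rewrite isEdge-topBit k b e | isEdge-topBit k b (swapAt p e) | card-swapAt p e
    with card e ≡ᵇ k in card≡k | twins
  ... | false | _ = refl
  ... | true | inj₁ equal = cong (true ∧_) (topBit-swapAt-equal p b e equal)
  ... | true | inj₂ 1+p<k =
    cong (true ∧_) (topBit-swapAt-large p b e (subst (suc p <_) (sym card≡k′) 1+p<k))
    where
    card≡k′ : card e ≡ k
    card≡k′ = ≡ᵇ⇒≡ (card e) k (subst T (sym card≡k) _)

  adjEntry-transpose : ∀ p → Twins p → suc p < n → ∀ i j →
    adjEntry k b (transpose p i) (transpose p j) ≡ adjEntry k b i j
  adjEntry-transpose p twins 1+p<n i j rewrite transpose-≡ᵇ p i j with i ≡ᵇ j
  ... | true = refl
  ... | false = begin
    countᵇ (λ e → at e (transpose p i) ∧ at e (transpose p j)) (edges k b)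
      ≡⟨ countᵇ-filterᵇ (isEdge k b) _ (subsets n) ⟩
    countᵇ (λ e → isEdge k b e ∧ (at e (transpose p i) ∧ at e (transpose p j))) (subsets n)
      ≡⟨ countᵇ-subsets-swapAt n p _ ⟩
    countᵇ (λ e → isEdge k b (swapAt p e) ∧ (at (swapAt p e) (transpose p i) ∧ at (swapAt p e) (transpose p j)))
           (subsets n)
      ≡⟨ countᵇ-cong (λ e → cong₂ _∧_ (isEdge-swapAt p twins e)
                                     (cong₂ _∧_ (at-swapAt p e 1+p<n i) (at-swapAt p e 1+p<n j))) (subsets n) ⟩
    countᵇ (λ e → isEdge k b e ∧ (at e i ∧ at e j)) (subsets n)
      ≡⟨ countᵇ-filterᵇ (isEdge k b) _ (subsets n) ⟨
    countᵇ (λ e → at e i ∧ at e j) (edges k b) ∎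
    where open ≡-Reasoning

  adjEntry-twins-column : ∀ p → Twins p → suc p < n → ∀ i → i ≢ p → i ≢ suc p →
    adjEntry k b i p ≡ adjEntry k b i (suc p)
  adjEntry-twins-column p twins 1+p<n i i≢p i≢1+p = begin
    adjEntry k b i p
      ≡⟨ adjEntry-transpose p twins 1+p<n i p ⟨
    adjEntry k b (transpose p i) (transpose p p)
      ≡⟨ cong₂ (adjEntry k b) (transpose-other p i i≢p i≢1+p) (transpose-left p) ⟩
    adjEntry k b i (suc p) ∎
    where open ≡-Reasoning

  adjEntry-twins-sym : ∀ p → Twins p → suc p < n → adjEntry k b (suc p) p ≡ adjEntry k b p (suc p)
  adjEntry-twins-sym p twins 1+p<n = begin
    adjEntry k b (suc p) p
      ≡⟨ cong₂ (adjEntry k b) (transpose-left p) (transpose-right p) ⟨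
    adjEntry k b (transpose p p) (transpose p (suc p))
      ≡⟨ adjEntry-transpose p twins 1+p<n p (suc p) ⟩
    adjEntry k b p (suc p) ∎
    where open ≡-Reasoning

  adjEntry-twins-step : ∀ p → Twins p → Twins (suc p) → suc (suc p) < n →
    adjEntry k b p (suc p) ≡ adjEntry k b (suc p) (suc (suc p))
  adjEntry-twins-step p twins twins′ 2+p<n = begin
    adjEntry k b p (suc p)
      ≡⟨ adjEntry-transpose (suc p) twins′ 2+p<n p (suc p) ⟨
    adjEntry k b (transpose (suc p) p) (transpose (suc p) (suc p))
      ≡⟨ cong₂ (adjEntry k b) (transpose-other (suc p) p p≢1+p p≢2+p) (transpose-left (suc p)) ⟩
    adjEntry k b p (suc (suc p))
      ≡⟨ adjEntry-transpose p twins (<-trans (n<1+n (suc p)) 2+p<n) p (suc (suc p)) ⟨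
    adjEntry k b (transpose p p) (transpose p (suc (suc p)))
      ≡⟨ cong (adjEntry k b (transpose p p)) (transpose-other p (suc (suc p)) (≢-sym p≢2+p) (≢-sym p≢1+p)) ⟩
    adjEntry k b (transpose p p) (suc (suc p))
      ≡⟨ cong (λ i → adjEntry k b i (suc (suc p))) (transpose-left p) ⟩
    adjEntry k b (suc p) (suc (suc p)) ∎
    where
    open ≡-Reasoning
    p≢1+p : ∀ {m} → m ≢ suc m
    p≢1+p = <⇒≢ (n<1+n _)
    p≢2+p : ∀ {m} → m ≢ suc (suc m)
    p≢2+p = <⇒≢ (m<n⇒m<1+n (n<1+n _))

  adjEntry-diag : ∀ x → adjEntry k b x x ≡ 0
  adjEntry-diag x rewrite Equivalence.to T-≡ (≡⇒≡ᵇ x x refl) = refl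

  diffVector-eigen : ∀ q → Twins q → suc q < n →
    IsEigenSolution (adjMatrix k b) (ℤ.- ℤ.+ adjEntry k b q (suc q)) (diffVector q)
  diffVector-eigen q twins 1+q<n i = begin
    sumFin (λ j → adjMatrix k b i j ℤ.* diffVector q j)
      ≡⟨ sumFin-unitDiff q (λ x → ℤ.+ adjEntry k b (toℕ i) x) 1+q<n ⟩
    ℤ.+ adjEntry k b (toℕ i) q ℤ.- ℤ.+ adjEntry k b (toℕ i) (suc q)
      ≡⟨ row (toℕ i) ⟩
    (ℤ.- ℤ.+ adjEntry k b q (suc q)) ℤ.* unitDiff q (toℕ i) ∎
    where
    open ≡-Reasoning
    row : ∀ x → ℤ.+ adjEntry k b x q ℤ.- ℤ.+ adjEntry k b x (suc q)
              ≡ (ℤ.- ℤ.+ adjEntry k b q (suc q)) ℤ.* unitDiff q x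
    row x with x ≟ q | x ≟ suc q
    ... | yes refl | _ rewrite adjEntry-diag x | unitDiff-self x = at-first (ℤ.+ adjEntry k b x (suc x))
      where
      at-first : ∀ a → 0ℤ ℤ.- a ≡ (ℤ.- a) ℤ.* 1ℤ
      at-first = solve-∀
    ... | no _ | yes refl rewrite adjEntry-diag x | unitDiff-next q | adjEntry-twins-sym q twins 1+q<n =
      at-second (ℤ.+ adjEntry k b q (suc q))
      where
      at-second : ∀ a → a ℤ.- 0ℤ ≡ (ℤ.- a) ℤ.* -1ℤ
      at-second = solve-∀
    ... | no x≢q | no x≢1+q
      rewrite unitDiff-other q x x≢q x≢1+q | adjEntry-twins-column q twins 1+q<n x x≢q x≢1+q =
      elsewhere (ℤ.+ adjEntry k b x (suc q)) (ℤ.- ℤ.+ adjEntry k b q (suc q))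
      where
      elsewhere : ∀ a μ → a ℤ.- a ≡ μ ℤ.* 0ℤ
      elsewhere = solve-∀

  TwinBlock : ℕ → ℕ → Set
  TwinBlock s a = s + a ≤ n × (∀ i → suc i < a → Twins (s + i))

  TwinBlocks : ℕ → List ℕ → Set
  TwinBlocks s [] = ⊤
  TwinBlocks s (a ∷ as) = TwinBlock s a × TwinBlocks (s + a) as

  twinBlock-adjEntry : ∀ {s a} → TwinBlock s a → ∀ i → suc i < a →
    adjEntry k b (s + i) (suc (s + i)) ≡ adjEntry k b s (suc s)
  twinBlock-adjEntry {s} _ zero _ rewrite +-identityʳ s = refl
  twinBlock-adjEntry {s} {a} block@(s+a≤n , twins) (suc i) 2+i<a = begin
    adjEntry k b (s + suc i) (suc (s + suc i))
      ≡⟨ cong (λ m → adjEntry k b m (suc m)) (+-suc s i) ⟩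
    adjEntry k b (suc (s + i)) (suc (suc (s + i)))
      ≡⟨ adjEntry-twins-step (s + i) (twins i 1+i<a) (subst Twins (+-suc s i) (twins (suc i) 2+i<a)) 2+s+i<n ⟨
    adjEntry k b (s + i) (suc (s + i))
      ≡⟨ twinBlock-adjEntry block i 1+i<a ⟩
    adjEntry k b s (suc s) ∎
    where
    open ≡-Reasoning
    1+i<a : suc i < a
    1+i<a = <-trans (n<1+n (suc i)) 2+i<a
    2+s+i<n : suc (suc (s + i)) < n
    2+s+i<n = subst (_< n) (trans (+-suc s (suc i)) (cong suc (+-suc s i)))
                           (<-≤-trans (+-monoʳ-< s 2+i<a) s+a≤n)

  EigenPosition : ℤ → ℕ → Set
  EigenPosition μ q = suc q < n × Twins q × ℤ.- ℤ.+ adjEntry k b q (suc q) ≡ μ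

  EigenPositions : ℤ → ℕ → ℕ → Set
  EigenPositions μ s m =
    Σ (List ℕ) λ Q → length Q ≡ m × AllPairs _<_ Q × All (s ≤_) Q × All (EigenPosition μ) Q

  prependBlock : ∀ {μ s a m} → TwinBlock s a → ℤ.- ℤ.+ adjEntry k b s (suc s) ≡ μ →
    EigenPositions μ (s + a) m → EigenPositions μ s (a ∸ 1 + m)
  prependBlock {μ} {s} {a} block@(s+a≤n , twins) value (Q , |Q| , sorted , bounded , eigen) =
    positions ++ Q ,
    trans (length-++ positions) (cong₂ _+_ (length-applyUpTo (s +_) (a ∸ 1)) |Q|) ,
    AllPairs.++⁺ (AllPairs.applyUpTo⁺₁ (s +_) (a ∸ 1) (λ i<j _ → +-monoʳ-< s i<j)) sorted
      (All.applyUpTo⁺₁ (s +_) (a ∸ 1) (λ i<a∸1 → All.map (<-≤-trans (+-monoʳ-< s (i<a i<a∸1))) bounded)) ,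
    All.++⁺ (All.applyUpTo⁺₁ (s +_) (a ∸ 1) (λ _ → m≤m+n s _)) (All.map (≤-trans (m≤m+n s a)) bounded) ,
    All.++⁺ (All.applyUpTo⁺₁ (s +_) (a ∸ 1) eigenPosition) eigen
    where
    positions : List ℕ
    positions = applyUpTo (s +_) (a ∸ 1)
    i<a : ∀ {i} → i < a ∸ 1 → i < a
    i<a i<a∸1 = <-trans (n<1+n _) (<∸1⇒1+< i<a∸1)
    eigenPosition : ∀ {i} → i < a ∸ 1 → EigenPosition μ (s + i)
    eigenPosition {i} i<a∸1 =
      subst (_< n) (+-suc s i) (<-≤-trans (+-monoʳ-< s (<∸1⇒1+< i<a∸1)) s+a≤n) ,
      twins i (<∸1⇒1+< i<a∸1) ,
      trans (cong (λ x → ℤ.- ℤ.+ x) (twinBlock-adjEntry block i (<∸1⇒1+< i<a∸1))) value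

  eigenPositions-weaken : ∀ {μ s s′ m} → s ≤ s′ → EigenPositions μ s′ m → EigenPositions μ s m
  eigenPositions-weaken s≤s′ (Q , |Q| , sorted , bounded , eigen) =
    Q , |Q| , sorted , All.map (≤-trans s≤s′) bounded , eigen

  eigenPositions : ∀ μ s as → TwinBlocks s as → EigenPositions μ s (targetFrom k b μ s as)
  eigenPositions μ s [] tt = [] , refl , [] , [] , []
  eigenPositions μ s (a ∷ as) (block , blocks) with 2 ≤ᵇ a | ℤ.- ℤ.+ adjEntry k b s (suc s) ℤ.≟ μ
  ... | true  | yes value = prependBlock block value (eigenPositions μ (s + a) as blocks)
  ... | true  | no _      = eigenPositions-weaken (m≤m+n s a) (eigenPositions μ (s + a) as blocks)
  ... | false | _         = eigenPositions-weaken (m≤m+n s a) (eigenPositions μ (s + a) as blocks)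

  twinBlocks-eigenMult : ∀ μ as → TwinBlocks 0 as →
    EigenMultAtLeast (adjMatrix k b) μ (targetFrom k b μ 0 as)
  twinBlocks-eigenMult μ as blocks with eigenPositions μ 0 as blocks
  ... | Q , |Q| , sorted , _ , eigen = subst (EigenMultAtLeast (adjMatrix k b) μ) |Q|
    (diffVectors Q ,
     diffVectors-linIndep Q sorted (All.map proj₁ eigen) ,
     λ t → eigenvector (All.lookup eigen (∈-lookup t)))
    where
    eigenvector : ∀ {q} → EigenPosition μ q → IsEigenSolution (adjMatrix k b) μ (diffVector q)
    eigenvector (1+q<n , twins , refl) = diffVector-eigen _ twins 1+q<n

  runBlock-twins : ∀ {s a} → RunBlock (at b) s a → ∀ i → suc i < a → Twins (s + i)
  runBlock-twins {s} (_ , const) i 1+i<a =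
    inj₁ (trans (const i (<-trans (n<1+n i) 1+i<a))
                (sym (trans (cong (at b) (sym (+-suc s i))) (const (suc i) 1+i<a))))

  runBlocks⇒twinBlocks : ∀ s as → RunBlocks (at b) s as → s + sum as ≡ n → TwinBlocks s as
  runBlocks⇒twinBlocks s [] tt _ = tt
  runBlocks⇒twinBlocks s (a ∷ as) (block , blocks) total =
    (subst (s + a ≤_) total′ (m≤m+n (s + a) (sum as)) , runBlock-twins block) ,
    runBlocks⇒twinBlocks (s + a) as blocks total′
    where
    total′ : s + a + sum as ≡ n
    total′ = trans (+-assoc s a (sum as)) total

  mergedRunBlocks⇒twinBlock : ∀ {r₁ r₂} → at b 0 ≡ false → at b (k ∸ 1) ≡ true →
    RunBlock (at b) 0 r₁ → RunBlock (at b) r₁ r₂ → r₁ + r₂ ≤ n → TwinBlock 0 (r₁ + r₂)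
  mergedRunBlocks⇒twinBlock {r₁} {r₂} first-zero kth-one (_ , const₁) block₂ r₁+r₂≤n = r₁+r₂≤n , twins
    where
    r₁≤k∸1 : r₁ ≤ k ∸ 1
    r₁≤k∸1 = ≮⇒≥ λ k∸1<r₁ →
      contradiction (trans (sym kth-one) (trans (const₁ (k ∸ 1) k∸1<r₁) first-zero)) λ ()
    twins : ∀ i → suc i < r₁ + r₂ → Twins i
    twins i 1+i<r₁+r₂ with suc i <? k
    ... | yes 1+i<k = inj₂ 1+i<k
    ... | no 1+i≮k = subst Twins r₁+[i∸r₁]≡i (runBlock-twins block₂ (i ∸ r₁) 1+i∸r₁<r₂)
      where
      r₁+[i∸r₁]≡i : r₁ + (i ∸ r₁) ≡ i
      r₁+[i∸r₁]≡i = m+[n∸m]≡n (≤-trans r₁≤k∸1 (∸-monoˡ-≤ 1 (≮⇒≥ 1+i≮k)))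
      1+i∸r₁<r₂ : suc (i ∸ r₁) < r₂
      1+i∸r₁<r₂ = +-cancelˡ-< r₁ (suc (i ∸ r₁)) r₂
        (subst (_< r₁ + r₂) (sym (trans (+-suc r₁ (i ∸ r₁)) (cong suc r₁+[i∸r₁]≡i))) 1+i<r₁+r₂)

  shortSeq-twinBlocks : at b 0 ≡ false → TwinBlocks 0 (shortSeq k b)
  shortSeq-twinBlocks first-zero with at b (k ∸ 1) in kth | runs (toList b) | runs-runBlocks b
  ... | false | as | blocks , total = runBlocks⇒twinBlocks 0 as blocks total
  ... | true | [] | _ = tt
  ... | true | a ∷ [] | blocks , total = runBlocks⇒twinBlocks 0 (a ∷ []) blocks total
  ... | true | r₁ ∷ r₂ ∷ as | (block₁ , block₂ , blocks) , total =
    mergedRunBlocks⇒twinBlock first-zero kth block₁ block₂ (subst (r₁ + r₂ ≤_) total′ (m≤m+n _ (sum as))) ,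
    runBlocks⇒twinBlocks (r₁ + r₂) as blocks total′
    where
    total′ : r₁ + r₂ + sum as ≡ n
    total′ = trans (+-assoc r₁ r₂ (sum as)) total

  shortSeq-sum : sum (shortSeq k b) ≡ n
  shortSeq-sum with at b (k ∸ 1)
  ... | false = proj₂ (runs-runBlocks b)
  ... | true = trans (sum-mergeFirstTwo (runs (toList b))) (proj₂ (runs-runBlocks b))

  shortSeq-positive : All (0 <_) (shortSeq k b)
  shortSeq-positive with at b (k ∸ 1)
  ... | false = runs-positive b
  ... | true = mergeFirstTwo-positive (runs-positive b)

at-zero-false : ∀ {k n} (b : Vec Bool n) → 2 ≤ k →
  (∀ (i : Fin n) → toℕ i < k ∸ 1 → lookup b i ≡ false) → at b 0 ≡ false
at-zero-false [] _ _ = refl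
at-zero-false (x ∷ b) (s≤s (s≤s _)) initial-zeros = initial-zeros Fin.zero z<s

corollary2 : (k n : ℕ) → 2 ≤ k → (b : Vec Bool n) →
    (∀ (i : Fin n) → toℕ i < k ∸ 1 → lookup b i ≡ false) →
    ((μ : ℤ) → EigenMultAtLeast (adjMatrix k b) μ (target k b μ))
    × (sum (map (λ a → a ∸ 1) (shortSeq k b)) ≡ n ∸ length (shortSeq k b))
corollary2 k n 2≤k b initial-zeros =
  (λ μ → twinBlocks-eigenMult k b μ S (shortSeq-twinBlocks k b (at-zero-false b 2≤k initial-zeros))) ,
  (begin
    sum (map (λ a → a ∸ 1) S)                       ≡⟨ m+n∸n≡m _ (length S) ⟨
    sum (map (λ a → a ∸ 1) S) + length S ∸ length S ≡⟨ cong (_∸ length S) (sum-map-pred S (shortSeq-positive k b)) ⟩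
    sum S ∸ length S                                ≡⟨ cong (_∸ length S) (shortSeq-sum k b) ⟩
    n ∸ length S                                    ∎)
  where
  open ≡-Reasoning
  S : List ℕ
  S = shortSeq k b
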